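{- Let $\tau=(\tau,\le,{}^*)$ be a regular tree set and $O$ a consistent orientation of $\tau$. Then the subposet $T(\tau,O)$ of $\tau$ induced on $\tau\setminus O$ is an order tree.
   Context: A separation system is a poset with an order-reversing involution ${}^*$; write $\overleftarrow s=\vec s^{\,*}$, $s=\{\vec s,\overleftarrow s\}$. $\vec s$ is degenerate if $\vec s=\overleftarrow s$, small if $\vec s\le\overleftarrow s$, trivial if there is a separation $t$ with $\vec s<\vec t$ and $\vec s<\overleftarrow t$. Regular: no small elements; essential: no trivial, no degenerate elements; nested: any two separations have comparable orientations; a tree set is a nested essential separation system. An orientation contains exactly one of $\vec s,\overleftarrow s$ for each separation; it is consistent if there are no distinct separations $r\ne s$ with orientations $\vec r<\vec s$ and $\overleftarrow r,\vec s$ both in it. An order tree is a poset in which for every element $t$ the set $\{s:s<t\}$ is a chain. -}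

module Defs where

open import Level using (Level; _⊔_; suc)
open import Data.Product using (Σ; _×_; _,_; ∃-syntax)
open import Data.Sum using (_⊎_)
open import Relation.Nullary using (¬_)
open import Relation.Binary.PropositionalEquality using (_≡_)
open import Relation.Binary.Structures using (IsPartialOrder)

record SeparationSystem (a ℓ : Level) : Set (Level.suc (a ⊔ ℓ)) where
  infix 4 _≤_ _<_
  field
    Carrier        : Set a
    _≤_            : Carrier → Carrier → Set ℓ
    isPartialOrder : IsPartialOrder _≡_ _≤_
    _*             : Carrier → Carrier
    involutive     : ∀ s → (s *) * ≡ s
    order-reversing : ∀ {r s} → r ≤ s → s * ≤ r *

  _<_ : Carrier → Carrier → Set (a ⊔ ℓ)
  r < s = (r ≤ s) × ¬ (r ≡ s)

  -- the underlying separations s = {s, s*} are equal iff r ≡ s or r ≡ s*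
  SameSeparation : Carrier → Carrier → Set a
  SameSeparation r s = (r ≡ s) ⊎ (r ≡ s *)

  Degenerate : Carrier → Set a
  Degenerate s = s ≡ s *

  Small : Carrier → Set ℓ
  Small s = s ≤ s *

  Trivial : Carrier → Set (a ⊔ ℓ)
  Trivial s = ∃[ t ] ((s < t) × (s < t *))

  Regular : Set (a ⊔ ℓ)
  Regular = ∀ s → ¬ Small s

  Essential : Set (a ⊔ ℓ)
  Essential = ∀ s → ¬ Trivial s × ¬ Degenerate s

  Nested : Set (a ⊔ ℓ)
  Nested = ∀ r s → (r ≤ s) ⊎ (r ≤ s *) ⊎ (r * ≤ s) ⊎ (r * ≤ s *)

  IsTreeSet : Set (a ⊔ ℓ)
  IsTreeSet = Nested × Essential

  IsOrientation : {p : Level} → (Carrier → Set p) → Set (a ⊔ p)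
  IsOrientation O = ∀ s → (O s ⊎ O (s *)) × ¬ (O s × O (s *))

  Consistent : {p : Level} → (Carrier → Set p) → Set (a ⊔ ℓ ⊔ p)
  Consistent O = ∀ r s → ¬ SameSeparation r s → r < s → ¬ (O (r *) × O s)

IsOrderTreeOn : {a ℓ p : Level} {A : Set a} → (A → A → Set ℓ) → (A → Set p)
              → Set (a ⊔ ℓ ⊔ p)
IsOrderTreeOn {A = A} _≤_ P =
  ∀ (t r s : A) → P t → P r → P s →
    (r ≤ t) × ¬ (r ≡ t) → (s ≤ t) × ¬ (s ≡ t) → (r ≤ s) ⊎ (s ≤ r)

module Submission where

-- Let t ∉ O and let r, s ∉ O lie strictly below t.  Since O is
-- an orientation, r* and s* lie in O.  Nestedness gives four cases:
--   * r ≤ s, or r* ≤ s* (i.e. s ≤ r): the two are comparable, as required;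
--   * r* ≤ s: then t* ≤ r* ≤ s ≤ t, so t* is small, contradicting regularity;
--   * r ≤ s*: then r < s* are distinct separations (again by regularity)
--     with r* and s* both in O, contradicting consistency.

open import Defs
open import Level using (Level)
open import Relation.Nullary using (¬_)
open import Data.Product using (_,_; proj₁)
open import Data.Sum using (_⊎_; inj₁; inj₂)
open import Data.Empty using (⊥-elim)
open import Relation.Binary.PropositionalEquality using (_≡_; subst; sym)
import Relation.Binary.PropositionalEquality as Eq
open import Relation.Binary.Structures using (IsPartialOrder)

module SeparationSystemFacts {a ℓ : Level} (τ : SeparationSystem a ℓ) where
  open SeparationSystem τ
  open IsPartialOrder isPartialOrder using (trans; reflexive)

  *-reflects : ∀ {x y} → x * ≤ y * → y ≤ x
  *-reflects {x} {y} h =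
    subst (_≤ x) (involutive y) (subst (y * * ≤_) (involutive x) (order-reversing h))

  -- Regularity also excludes co-small separations s* ≤ s (as s* would be small).
  regular⇒¬co-small : Regular → ∀ s → ¬ (s * ≤ s)
  regular⇒¬co-small reg s h = reg (s *) (subst (s * ≤_) (sym (involutive s)) h)

  -- In a regular system, if r and s have a common upper bound t then r* ≰ s:
  -- otherwise t* ≤ r* ≤ s ≤ t would make t co-small.
  common-upper-bound⇒¬*≤ : Regular → ∀ {r s t} → r ≤ t → s ≤ t → ¬ (r * ≤ s)
  common-upper-bound⇒¬*≤ reg {t = t} r≤t s≤t r*≤s =
    regular⇒¬co-small reg t (trans (order-reversing r≤t) (trans r*≤s s≤t))

  -- In particular r ≢ s* for such r and s, since then r* = s ≤ s.
  common-upper-bound⇒≢* : Regular → ∀ {r s t} → r ≤ t → s ≤ t → ¬ (r ≡ s *)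
  common-upper-bound⇒≢* reg r≤t s≤t r≡s* =
    common-upper-bound⇒¬*≤ reg r≤t s≤t
      (reflexive (Eq.trans (Eq.cong _* r≡s*) (involutive _)))

  -- In a regular system, distinct comparable orientations r < s belong to
  -- distinct separations: r ≡ s* would make s co-small.
  regular⇒<-distinct : Regular → ∀ {r s} → r < s → ¬ SameSeparation r s
  regular⇒<-distinct reg (_   , r≢s) (inj₁ r≡s)  = r≢s r≡s
  regular⇒<-distinct reg (r≤s , _)   (inj₂ r≡s*) =
    regular⇒¬co-small reg _ (subst (_≤ _) r≡s* r≤s)

  orientation-∌⇒∋* : ∀ {p} {O : Carrier → Set p} → IsOrientation O →
                     ∀ x → ¬ O x → O (x *)
  orientation-∌⇒∋* orient x x∉O with proj₁ (orient x)
  ... | inj₁ x∈O  = ⊥-elim (x∉O x∈O)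
  ... | inj₂ x*∈O = x*∈O

  omitted-below-common-bound⇒comparable :
    Regular → ∀ {p} {O : Carrier → Set p} → IsOrientation O → Consistent O →
    ∀ {r s t} → ¬ O r → ¬ O s → r ≤ t → s ≤ t →
    (r ≤ s) ⊎ (r ≤ s *) ⊎ (r * ≤ s) ⊎ (r * ≤ s *) → (r ≤ s) ⊎ (s ≤ r)
  omitted-below-common-bound⇒comparable _ _ _ _ _ _ _ (inj₁ r≤s) = inj₁ r≤s
  omitted-below-common-bound⇒comparable _ _ _ _ _ _ _ (inj₂ (inj₂ (inj₂ r*≤s*))) =
    inj₂ (*-reflects r*≤s*)
  omitted-below-common-bound⇒comparable reg _ _ _ _ r≤t s≤t (inj₂ (inj₂ (inj₁ r*≤s))) =
    ⊥-elim (common-upper-bound⇒¬*≤ reg r≤t s≤t r*≤s)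
  omitted-below-common-bound⇒comparable reg orient consistent {r} {s} r∉O s∉O r≤t s≤t
    (inj₂ (inj₁ r≤s*)) =
    ⊥-elim (consistent r (s *) (regular⇒<-distinct reg r<s*) r<s*
             (orientation-∌⇒∋* orient r r∉O , orientation-∌⇒∋* orient s s∉O))
    where
    r<s* : r < s *
    r<s* = r≤s* , common-upper-bound⇒≢* reg r≤t s≤t

lemma4p3 : {a ℓ p : Level} (τ : SeparationSystem a ℓ) →
    let open SeparationSystem τ in
    Regular → IsTreeSet →
    (O : Carrier → Set p) → IsOrientation O → Consistent O →
    IsOrderTreeOn _≤_ (λ s → ¬ O s)
lemma4p3 τ reg (nested , _) O orient consistent t r s _ r∉O s∉O (r≤t , _) (s≤t , _) =
  omitted-below-common-bound⇒comparable reg orient consistent r∉O s∉O r≤t s≤t (nested r s)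
  where open SeparationSystemFacts τ
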